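{- Let $G$ be a connected graph of order at least $2$ without true twins and let $H$ be a connected non-complete graph. (i) If $H$ has no universal vertex, then $\mathrm{gp}_{\rm o}(G\circ H)=\mathrm{gp}_{\rm o}(G)\,\mathrm{gp}_{\rm o}(K_1+H)$. (ii) If $\operatorname{diam}(H)=2$, then $\mathrm{gp}_{\rm o}(G\circ H)=\mathrm{gp}_{\rm o}(G)\,\mathrm{gp}_{\rm o}(H)$. (iii) If $H$ has no true twins, then $\mathrm{gp}_{\rm o}(G\circ H)=\mathrm{gp}_{\rm o}(G)\,\alpha(H)$.
   Context: All graphs are finite and simple, and (as a standing assumption of the paper) connected. For $X\subseteq V(G)$, two vertices $u,v$ are $X$-positionable if no shortest $u,v$-path has an internal vertex in $X$. $X$ is an outer general position set if every two vertices of $X$ are $X$-positionable and every $u\in X$, $v\in V(G)\setminus X$ are $X$-positionable; $\mathrm{gp}_{\rm o}$ is the maximum cardinality of such a set. Vertices $u,v$ are true twins if $N[u]=N[v]$. A universal vertex is adjacent to all other vertices. $K_1+H$ is the join of $K_1$ with $H$ (a new vertex adjacent to all of $V(H)$). $\alpha$ is the independence number. The lexicographic product $G\circ H$ has vertex set $V(G)\times V(H)$, with $(g,h)$ and $(g',h')$ adjacent iff either $gg'\in E(G)$, or $g=g'$ and $hh'\in E(H)$. -}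

module Defs where

open import Data.Nat using (ℕ; zero; suc; _+_; _*_; _≤_)
open import Data.Fin using (Fin; remQuot) renaming (zero to fz; suc to fs)
open import Data.Fin.Properties using (_≟_)
open import Data.Fin.Subset using (Subset; _∈_; _∉_; ∣_∣)
open import Data.Bool using (Bool; true; false; _∨_; _∧_)
open import Data.Bool.Properties using (∨-comm)
open import Data.Product using (Σ; ∃; ∃-syntax; _×_; _,_; proj₁; proj₂)
open import Data.Sum using (_⊎_)
open import Relation.Nullary using (¬_; yes; no)
open import Relation.Nullary.Decidable using (⌊_⌋)
open import Relation.Binary.PropositionalEquality using (_≡_; _≢_; refl; sym; cong₂)
open import Function.Bundles using (_⇔_)

record Graph : Set where
  field
    n      : ℕ
    adj    : Fin n → Fin n → Bool
    adj-sym : ∀ u v → adj u v ≡ adj v u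
    adj-irrefl : ∀ v → adj v v ≡ false

open Graph public using (n; adj; adj-sym; adj-irrefl)

V : Graph → Set
V G = Fin (n G)

Adj : (G : Graph) → V G → V G → Set
Adj G u v = adj G u v ≡ true

data Walk (G : Graph) : V G → V G → Set where
  nil  : ∀ {u} → Walk G u u
  cons : ∀ {u w v} → Adj G u w → Walk G w v → Walk G u v

len : ∀ {G u v} → Walk G u v → ℕ
len nil        = 0
len (cons _ p) = suc (len p)

-- x is an internal vertex of the walk (neither the first nor the last vertex
-- position of the walk).
data Internal {G : Graph} (x : V G) : ∀ {u v} → Walk G u v → Set where
  here  : ∀ {u v w} {e : Adj G u x} {e' : Adj G x w} {p : Walk G w v} →
          Internal x (cons e (cons e' p))
  there : ∀ {u w v} {e : Adj G u w} {p : Walk G w v} →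
          Internal x p → Internal x (cons e p)

IsShortest : ∀ {G u v} → Walk G u v → Set
IsShortest {G} {u} {v} p = ∀ (q : Walk G u v) → len p ≤ len q

Connected : Graph → Set
Connected G = ∀ (u v : V G) → Walk G u v

Positionable : (G : Graph) → Subset (n G) → V G → V G → Set
Positionable G X u v =
  ∀ (p : Walk G u v) → IsShortest p → ∀ x → Internal x p → x ∉ X

IsOuterGP : (G : Graph) → Subset (n G) → Set
IsOuterGP G X =
  (∀ u v → u ∈ X → v ∈ X → Positionable G X u v) ×
  (∀ u v → u ∈ X → v ∉ X → Positionable G X u v)

IsGpo : Graph → ℕ → Set
IsGpo G k =
  (∃[ X ] (IsOuterGP G X × ∣ X ∣ ≡ k)) ×
  (∀ X → IsOuterGP G X → ∣ X ∣ ≤ k)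

Independent : (G : Graph) → Subset (n G) → Set
Independent G X = ∀ u v → u ∈ X → v ∈ X → ¬ Adj G u v

IsAlpha : Graph → ℕ → Set
IsAlpha G k =
  (∃[ X ] (Independent G X × ∣ X ∣ ≡ k)) ×
  (∀ X → Independent G X → ∣ X ∣ ≤ k)

ClosedNbhd : (G : Graph) → V G → V G → Set
ClosedNbhd G u w = (w ≡ u) ⊎ Adj G u w

TrueTwins : (G : Graph) → V G → V G → Set
TrueTwins G u v = u ≢ v × (∀ w → ClosedNbhd G u w ⇔ ClosedNbhd G v w)

NoTrueTwins : Graph → Set
NoTrueTwins G = ∀ u v → ¬ TrueTwins G u v

Universal : (G : Graph) → V G → Set
Universal G u = ∀ w → w ≢ u → Adj G u w

HasUniversal : Graph → Set
HasUniversal G = ∃[ u ] Universal G u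

Complete : Graph → Set
Complete G = ∀ u v → u ≢ v → Adj G u v

Diam : Graph → ℕ → Set
Diam G d =
  (∀ u v → ∃[ p ] (len {G} {u} {v} p ≤ d)) ×
  (∃[ u ] ∃[ v ] (∀ (p : Walk G u v) → d ≤ len p))

private
  ≟-sym : ∀ {m} (a c : Fin m) → ⌊ a ≟ c ⌋ ≡ ⌊ c ≟ a ⌋
  ≟-sym a c with a ≟ c | c ≟ a
  ... | yes _ | yes _ = refl
  ... | no _  | no _  = refl
  ... | yes p | no q  = Data.Empty.⊥-elim (q (sym p))
    where import Data.Empty
  ... | no p  | yes q = Data.Empty.⊥-elim (p (sym q))
    where import Data.Empty

  ≟-refl : ∀ {m} (a : Fin m) → ⌊ a ≟ a ⌋ ≡ true
  ≟-refl a with a ≟ a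
  ... | yes _ = refl
  ... | no q  = Data.Empty.⊥-elim (q refl)
    where import Data.Empty

lexAdj₀ : (G H : Graph) → (V G × V H) → (V G × V H) → Bool
lexAdj₀ G H (a , b) (c , d) = adj G a c ∨ (⌊ a ≟ c ⌋ ∧ adj H b d)

lexAdj : (G H : Graph) → Fin (n G * n H) → Fin (n G * n H) → Bool
lexAdj G H x y = lexAdj₀ G H (remQuot (n H) x) (remQuot (n H) y)

lexSym₀ : (G H : Graph) → ∀ x y → lexAdj₀ G H x y ≡ lexAdj₀ G H y x
lexSym₀ G H (a , b) (c , d) =
  cong₂ _∨_ (adj-sym G a c) (cong₂ _∧_ (≟-sym a c) (adj-sym H b d))

lexSym : (G H : Graph) → ∀ x y → lexAdj G H x y ≡ lexAdj G H y x
lexSym G H x y = lexSym₀ G H (remQuot (n H) x) (remQuot (n H) y)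

lexIrr₀ : (G H : Graph) → ∀ x → lexAdj₀ G H x x ≡ false
lexIrr₀ G H (a , b) rewrite adj-irrefl G a | ≟-refl a | adj-irrefl H b = refl

lexIrr : (G H : Graph) → ∀ x → lexAdj G H x x ≡ false
lexIrr G H x = lexIrr₀ G H (remQuot (n H) x)

-- Lexicographic product G ∘ H; vertex (g , h) is encoded as combine g h.
_∘L_ : Graph → Graph → Graph
G ∘L H = record { n = n G * n H ; adj = lexAdj G H
                ; adj-sym = lexSym G H ; adj-irrefl = lexIrr G H }

joinAdj : (H : Graph) → Fin (suc (n H)) → Fin (suc (n H)) → Bool
joinAdj H fz     fz     = false
joinAdj H fz     (fs _) = true
joinAdj H (fs _) fz     = true
joinAdj H (fs u) (fs v) = adj H u v

joinSym : (H : Graph) → ∀ x y → joinAdj H x y ≡ joinAdj H y x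
joinSym H fz     fz     = refl
joinSym H fz     (fs _) = refl
joinSym H (fs _) fz     = refl
joinSym H (fs u) (fs v) = adj-sym H u v

joinIrr : (H : Graph) → ∀ x → joinAdj H x x ≡ false
joinIrr H fz     = refl
joinIrr H (fs u) = adj-irrefl H u

K₁+_ : Graph → Graph
K₁+ H = record { n = suc (n H) ; adj = joinAdj H
               ; adj-sym = joinSym H ; adj-irrefl = joinIrr H }

-- Call S ⊆ V(H) twin-closed (AdjacentTwins) when any two adjacent vertices of S are true twins.
-- As G has no isolated vertices, the distance in G ∘ H between different G-fibres is the
-- distance in G of their indices, and within a fibre it is at most 2.  Hence an outer general
-- position set of G ∘ H projects onto an outer general position set of G and meets every fibre
-- in a twin-closed set of H; conversely P × S is in outer general position when P is (P is then
-- independent, G having no true twins) and S is twin-closed.  So gpo(G ∘ H) = gpo(G) · m, m the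
-- largest size of a twin-closed set of H.  In a graph of diameter at most 2, such as H in (ii)
-- and K₁ + H, twin-closed sets are exactly the outer general position sets; in K₁ + H the apex
-- is twin-closed only with universal vertices of H.  Without true twins, twin-closed means independent.
module Submission where

open import Defs
open import Data.Nat using (ℕ; zero; suc; _+_; _*_; _≤_; z≤n; s≤s)
open import Data.Nat.Properties
  using (module ≤-Reasoning; +-suc; +-cancelʳ-≤; +-mono-≤; *-monoˡ-≤; ≤-trans; ≤-antisym; ≤-pred; ≤⇒≯; m≤n⇒m≤1+n; ≤-reflexive)
open import Data.Fin using (Fin; combine; remQuot; punchIn) renaming (zero to fz; suc to fs)
open import Data.Fin.Properties using (_≟_; suc-injective; punchInᵢ≢i; remQuot-combine; combine-remQuot)
open import Data.Fin.Subset using (Subset; _∈_; ∣_∣; ⊥; ⁅_⁆; Nonempty)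
open import Data.Fin.Subset.Properties using (_∈?_; drop-there; nonempty?; Empty-unique; ∣⊥∣≡0; ∉⊥; x∈⁅y⁆⇒x≡y; ∣⁅x⁆∣≡1)
open import Data.Vec using (Vec; []; _∷_; _++_; concat; map; lookup; group) renaming (here to hereᵛ; there to thereᵛ)
open import Data.Vec.Properties using (lookup-concat; []=⇒lookup; lookup⇒[]=)
open import Data.Bool using (Bool; true; false; if_then_else_)
open import Data.Product using (∃-syntax; _×_; _,_; proj₁; proj₂; map₁)
open import Data.Sum using (_⊎_; inj₁; inj₂)
open import Data.Empty using (⊥-elim)
open import Relation.Nullary using (¬_; yes; no; does)
open import Relation.Binary.PropositionalEquality using (_≡_; _≢_; refl; sym; trans; cong; subst; subst₂; cong₂)
open import Function.Bundles using (mk⇔)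

Adj-sym : ∀ G {u v} → Adj G u v → Adj G v u
Adj-sym G {u} {v} e = trans (adj-sym G v u) e

Adj-irrefl : ∀ G {u} → ¬ Adj G u u
Adj-irrefl G {u} e with () ← trans (sym e) (adj-irrefl G u)

_++ʷ_ : ∀ {G u v w} → Walk G u v → Walk G v w → Walk G u w
nil      ++ʷ q = q
cons e p ++ʷ q = cons e (p ++ʷ q)

len-++ʷ : ∀ {G u v w} (p : Walk G u v) (q : Walk G v w) → len (p ++ʷ q) ≡ len p + len q
len-++ʷ nil        q = refl
len-++ʷ (cons e p) q = cong suc (len-++ʷ p q)

_▷_ : ∀ {G u v w} → Walk G u v → Adj G v w → Walk G u w
nil      ▷ e = cons e nil
cons e p ▷ f = cons e (p ▷ f)

len-▷ : ∀ {G u v w} (p : Walk G u v) (e : Adj G v w) → len (p ▷ e) ≡ suc (len p)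
len-▷ nil        e = refl
len-▷ (cons e p) f = cong suc (len-▷ p f)

internal-▷ : ∀ {G u v w} (p : Walk G u v) (e : Adj G v w) → 1 ≤ len p → Internal v (p ▷ e)
internal-▷ (cons e nil)        f _ = here
internal-▷ (cons e (cons d p)) f _ = there (internal-▷ (cons d p) f (s≤s z≤n))

≡⇒walk : ∀ {G u v} → u ≡ v → Walk G u v
≡⇒walk refl = nil

len-≡⇒walk : ∀ {G u v} (eq : u ≡ v) → len (≡⇒walk {G} eq) ≡ 0
len-≡⇒walk refl = refl

len-subst : ∀ {G u u′ v} (eq : u ≡ u′) (p : Walk G u v) → len (subst (λ w → Walk G w v) eq p) ≡ len p
len-subst refl p = refl

len≡1⇒adj : ∀ {G u v} (p : Walk G u v) → len p ≡ 1 → Adj G u v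
len≡1⇒adj (cons e nil) _ = e

walk-nonempty : ∀ {G u v} (p : Walk G u v) → u ≢ v → 1 ≤ len p
walk-nonempty nil        u≢v = ⊥-elim (u≢v refl)
walk-nonempty (cons e p) _   = s≤s z≤n

record SplitAt {G u v} (x : V G) (q : Walk G u v) : Set where
  field
    {next} : V G
    prefix : Walk G u x
    edge   : Adj G x next
    suffix : Walk G next v
    prefix-nonempty : 1 ≤ len prefix
    len-split : len q ≡ len prefix + suc (len suffix)

splitAt : ∀ {G u v x} (q : Walk G u v) → Internal x q → SplitAt x q
splitAt (cons e (cons f p)) here = record
  { prefix = cons e nil ; edge = f ; suffix = p ; prefix-nonempty = s≤s z≤n ; len-split = refl }
splitAt (cons e p) (there i) = record
  { prefix = cons e (prefix s) ; edge = edge s ; suffix = suffix s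
  ; prefix-nonempty = s≤s z≤n ; len-split = cong suc (len-split s) }
  where s = splitAt p i
        open SplitAt

DistAtLeast : (G : Graph) → V G → V G → ℕ → Set
DistAtLeast G u v k = ∀ (q : Walk G u v) → k ≤ len q

distAtLeast-weaken : ∀ {G u v k k′} → k ≤ k′ → DistAtLeast G u v k′ → DistAtLeast G u v k
distAtLeast-weaken k≤k′ dist q = ≤-trans k≤k′ (dist q)

NoIsolated : Graph → Set
NoIsolated G = ∀ g → ∃[ g′ ] Adj G g g′

DiamAtMost : Graph → ℕ → Set
DiamAtMost G d = ∀ u v → ∃[ p ] (len {G} {u} {v} p ≤ d)

NoGeodesicThrough : (G : Graph) → Subset (n G) → Set
NoGeodesicThrough G X = ∀ {u z y} → u ∈ X → z ∈ X → Adj G z y →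
  (p : Walk G u z) → 1 ≤ len p → ¬ DistAtLeast G u y (suc (len p))

noGeodesicThrough⇒outerGP : ∀ {G} X → NoGeodesicThrough G X → IsOuterGP G X
noGeodesicThrough⇒outerGP {G} X ngt = (λ u v u∈X _ → positionable u∈X) , (λ u v u∈X _ → positionable u∈X)
  where
  positionable : ∀ {u v} → u ∈ X → Positionable G X u v
  positionable u∈X q q-shortest x x∈q x∈X =
    ngt u∈X x∈X edge prefix prefix-nonempty prefix-geodesic
    where
    open SplitAt (splitAt q x∈q)
    prefix-geodesic : DistAtLeast G _ next (suc (len prefix))
    prefix-geodesic q′ = +-cancelʳ-≤ (len suffix) _ _ (begin
      suc (len prefix) + len suffix ≡⟨ sym (+-suc (len prefix) (len suffix)) ⟩
      len prefix + suc (len suffix) ≡⟨ sym len-split ⟩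
      len q                          ≤⟨ q-shortest (q′ ++ʷ suffix) ⟩
      len (q′ ++ʷ suffix)            ≡⟨ len-++ʷ q′ suffix ⟩
      len q′ + len suffix            ∎)
      where open ≤-Reasoning

▷-shortest : ∀ {G u v w} (p : Walk G u v) (e : Adj G v w) →
  DistAtLeast G u w (suc (len p)) → IsShortest (p ▷ e)
▷-shortest p e p▷e-geodesic q = subst (_≤ len q) (sym (len-▷ p e)) (p▷e-geodesic q)

outerGP⇒noGeodesicThrough : ∀ {G} X → IsOuterGP G X → NoGeodesicThrough G X
outerGP⇒noGeodesicThrough X (inside , outside) {u} {z} {y} u∈X z∈X e p p-nonempty geodesic
  with y ∈? X
... | yes y∈X = inside  u y u∈X y∈X (p ▷ e) (▷-shortest p e geodesic) z (internal-▷ p e p-nonempty) z∈X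
... | no  y∉X = outside u y u∈X y∉X (p ▷ e) (▷-shortest p e geodesic) z (internal-▷ p e p-nonempty) z∈X

-- Stated as the inclusion N[z] ⊆ N[u]; since u and z may be swapped, adjacent members of S are true twins.
AdjacentTwins : (G : Graph) → Subset (n G) → Set
AdjacentTwins G S = ∀ {u z w} → u ∈ S → z ∈ S → Adj G u z → Adj G z w → w ≢ u → Adj G u w

module _ {G : Graph} where

  adj-dec : ∀ u v → Adj G u v ⊎ ¬ Adj G u v
  adj-dec u v with adj G u v
  ... | true  = inj₁ refl
  ... | false = inj₂ λ ()

  distAtLeast-2 : ∀ {u v} → u ≢ v → ¬ Adj G u v → DistAtLeast G u v 2
  distAtLeast-2 u≢v ¬e nil                 = ⊥-elim (u≢v refl)
  distAtLeast-2 u≢v ¬e (cons e nil)        = ⊥-elim (¬e e)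
  distAtLeast-2 u≢v ¬e (cons e (cons f q)) = s≤s (s≤s z≤n)

  ≡⇒¬distAtLeast : ∀ {u v k} → u ≡ v → 1 ≤ k → ¬ DistAtLeast G u v k
  ≡⇒¬distAtLeast refl 1≤k dist = ≤⇒≯ (dist nil) 1≤k

  adj⇒¬distAtLeast : ∀ {u v k} → Adj G u v → 2 ≤ k → ¬ DistAtLeast G u v k
  adj⇒¬distAtLeast e 2≤k dist = ≤⇒≯ (dist (cons e nil)) 2≤k

  short-geodesic⇒adj : ∀ {u z y} (p : Walk G u z) → 1 ≤ len p →
    DistAtLeast G u y (suc (len p)) → ∃[ q ] (len {G} {u} {y} q ≤ 2) → Adj G u z
  short-geodesic⇒adj p p-nonempty geodesic (q , q≤2) =
    len≡1⇒adj p (≤-antisym (≤-pred (≤-trans (geodesic q) q≤2)) p-nonempty)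

  outerGP⇒adjacentTwins : ∀ X → IsOuterGP G X → AdjacentTwins G X
  outerGP⇒adjacentTwins X ogp {u} {z} {w} u∈X z∈X u~z z~w w≢u with adj-dec u w
  ... | inj₁ u~w = u~w
  ... | inj₂ u≁w = ⊥-elim (outerGP⇒noGeodesicThrough X ogp u∈X z∈X z~w (cons u~z nil) (s≤s z≤n)
                             (distAtLeast-2 (λ u≡w → w≢u (sym u≡w)) u≁w))

  adjacentTwins⇒outerGP : DiamAtMost G 2 → ∀ X → AdjacentTwins G X → IsOuterGP G X
  adjacentTwins⇒outerGP diam X twins = noGeodesicThrough⇒outerGP X ngt
    where
    ngt : NoGeodesicThrough G X
    ngt {u} {z} {y} u∈X z∈X z~y p p-nonempty geodesic with y ≟ u
    ... | yes y≡u = ≡⇒¬distAtLeast (sym y≡u) (s≤s z≤n) geodesic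
    ... | no  y≢u = adj⇒¬distAtLeast u~y (s≤s p-nonempty) geodesic
      where
      u~y : Adj G u y
      u~y = twins u∈X z∈X (short-geodesic⇒adj p p-nonempty geodesic (diam u y)) z~y y≢u

  independent⇒adjacentTwins : ∀ S → Independent G S → AdjacentTwins G S
  independent⇒adjacentTwins S indep {u} {z} u∈S z∈S u~z = ⊥-elim (indep u z u∈S z∈S u~z)

  adjacentTwins⇒independent : NoTrueTwins G → ∀ S → AdjacentTwins G S → Independent G S
  adjacentTwins⇒independent noTwins S twins u v u∈S v∈S u~v =
    noTwins u v ((λ { refl → Adj-irrefl G u~v }) , λ w → mk⇔ (⊆ u∈S v∈S (Adj-sym G u~v)) (⊆ v∈S u∈S u~v))
    where
    ⊆ : ∀ {a b w} → a ∈ S → b ∈ S → Adj G b a → ClosedNbhd G a w → ClosedNbhd G b w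
    ⊆ a∈S b∈S b~a (inj₁ refl) = inj₂ b~a
    ⊆ {a} {b} {w} a∈S b∈S b~a (inj₂ a~w) with w ≟ b
    ... | yes refl = inj₁ refl
    ... | no  w≢b  = inj₂ (twins b∈S a∈S b~a a~w w≢b)

∣++∣ : ∀ {a b} (p : Subset a) (q : Subset b) → ∣ p ++ q ∣ ≡ ∣ p ∣ + ∣ q ∣
∣++∣ []          q = refl
∣++∣ (true  ∷ p) q = cong suc (∣++∣ p q)
∣++∣ (false ∷ p) q = ∣++∣ p q

module _ {k : ℕ} where

  rowOf : Subset k → Bool → Subset k
  rowOf S b = if b then S else ⊥

  occupied : ∀ {a} → Vec (Subset k) a → Subset a
  occupied = map (λ r → does (nonempty? r))

  ∈-occupied : ∀ {a} (xss : Vec (Subset k) a) {g} → g ∈ occupied xss → Nonempty (lookup xss g)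
  ∈-occupied (r ∷ xss) {fz} g∈ with nonempty? r
  ... | yes ne = ne
  ∈-occupied (r ∷ xss) {fs g} g∈ = ∈-occupied xss (drop-there g∈)

  ∣concat∣≤∣occupied∣* : ∀ {a} (xss : Vec (Subset k) a) {c} → (∀ g → ∣ lookup xss g ∣ ≤ c) →
    ∣ concat xss ∣ ≤ ∣ occupied xss ∣ * c
  ∣concat∣≤∣occupied∣* []        rows≤ = z≤n
  ∣concat∣≤∣occupied∣* (r ∷ xss) rows≤ rewrite ∣++∣ r (concat xss) with nonempty? r
  ... | yes _       = +-mono-≤ (rows≤ fz) (∣concat∣≤∣occupied∣* xss (λ g → rows≤ (fs g)))
  ... | no  r-empty rewrite Empty-unique r-empty | ∣⊥∣≡0 k = ∣concat∣≤∣occupied∣* xss (λ g → rows≤ (fs g))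

module _ {m k : ℕ} where

  combine∈concat⁻ : ∀ (xss : Vec (Subset k) m) {g h} → combine g h ∈ concat xss → h ∈ lookup xss g
  combine∈concat⁻ xss {g} {h} gh∈ = lookup⇒[]= h _ (trans (sym (lookup-concat xss g h)) ([]=⇒lookup gh∈))

  combine∈concat⁺ : ∀ (xss : Vec (Subset k) m) {g h} → h ∈ lookup xss g → combine g h ∈ concat xss
  combine∈concat⁺ xss {g} {h} h∈ = lookup⇒[]= (combine g h) _ (trans (lookup-concat xss g h) ([]=⇒lookup h∈))

  -- P × S, laid out row by row as in the numbering of Fin (m * k) by combine.
  _⊠_ : Subset m → Subset k → Subset (m * k)
  P ⊠ S = concat (map (rowOf S) P)

  ∣⊠∣ : ∀ (P : Subset m) S → ∣ P ⊠ S ∣ ≡ ∣ P ∣ * ∣ S ∣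
  ∣⊠∣ P S = go P
    where
    go : ∀ {a} (P : Subset a) → ∣ concat (map (rowOf S) P) ∣ ≡ ∣ P ∣ * ∣ S ∣
    go []          = refl
    go (true  ∷ P) = trans (∣++∣ S _) (cong (∣ S ∣ +_) (go P))
    go (false ∷ P) = trans (∣++∣ (⊥ {k}) _) (cong₂ _+_ (∣⊥∣≡0 k) (go P))

  combine∈⊠ : ∀ {P : Subset m} {S g h} → combine g h ∈ P ⊠ S → g ∈ P × h ∈ S
  combine∈⊠ {P} {S} gh∈ = row (combine∈concat⁻ (map (rowOf S) P) gh∈)
    where
    row : ∀ {a} {P : Subset a} {g h} → h ∈ lookup (map (rowOf S) P) g → g ∈ P × h ∈ S
    row {P = true  ∷ P} {fz}   h∈ = hereᵛ , h∈
    row {P = false ∷ P} {fz}   h∈ = ⊥-elim (∉⊥ h∈)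
    row {P = _     ∷ _} {fs _} h∈ = map₁ thereᵛ (row h∈)

-- IsGpo G and IsAlpha G unfold to Maximum (IsOuterGP G) and Maximum (Independent G).
Maximum : ∀ {k} → (Subset k → Set) → ℕ → Set
Maximum P m = (∃[ X ] (P X × ∣ X ∣ ≡ m)) × (∀ X → P X → ∣ X ∣ ≤ m)

maximum-resp-⇔ : ∀ {k} {P Q : Subset k → Set} {m} →
  (∀ X → P X → Q X) → (∀ X → Q X → P X) → Maximum P m → Maximum Q m
maximum-resp-⇔ P⇒Q Q⇒P ((X , PX , ∣X∣≡m) , bound) = (X , P⇒Q X PX , ∣X∣≡m) , λ Y QY → bound Y (Q⇒P Y QY)

module Lex (G H : Graph) where

  Γ : Graph
  Γ = G ∘L H

  fst : V Γ → V G
  fst x = proj₁ (remQuot {n G} (n H) x)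

  snd : V Γ → V H
  snd x = proj₂ (remQuot {n G} (n H) x)

  fst-combine : ∀ g h → fst (combine g h) ≡ g
  fst-combine g h = cong proj₁ (remQuot-combine {n G} {n H} g h)

  snd-combine : ∀ g h → snd (combine g h) ≡ h
  snd-combine g h = cong proj₂ (remQuot-combine {n G} {n H} g h)

  combine-fst-snd : ∀ x → combine (fst x) (snd x) ≡ x
  combine-fst-snd x = combine-remQuot {n G} (n H) x

  vertex-≡ : ∀ {x y} → fst x ≡ fst y → snd x ≡ snd y → x ≡ y
  vertex-≡ {x} {y} fst≡ snd≡ =
    trans (sym (combine-fst-snd x)) (trans (cong₂ combine fst≡ snd≡) (combine-fst-snd y))

  adj-lex : ∀ {x y} → Adj Γ x y → Adj G (fst x) (fst y) ⊎ (fst x ≡ fst y × Adj H (snd x) (snd y))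
  adj-lex {x} {y} x~y with adj G (fst x) (fst y) | fst x ≟ fst y
  ... | true  | _        = inj₁ refl
  ... | false | yes fst≡ = inj₂ (fst≡ , x~y)

  adj-across : ∀ {x y} → Adj G (fst x) (fst y) → Adj Γ x y
  adj-across {x} {y} e rewrite e = refl

  adj-within : ∀ {x y} → fst x ≡ fst y → Adj H (snd x) (snd y) → Adj Γ x y
  adj-within {x} {y} fst≡ e with adj G (fst x) (fst y) | fst x ≟ fst y
  ... | true  | _       = refl
  ... | false | yes _   = e
  ... | false | no fst≢ = ⊥-elim (fst≢ fst≡)

  project : ∀ {x y} → Walk Γ x y → Walk G (fst x) (fst y)
  project nil = nil
  project (cons e q) with adj-lex e
  ... | inj₁ e′          = cons e′ (project q)
  ... | inj₂ (fst≡ , _) = subst (λ g → Walk G g _) (sym fst≡) (project q)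

  len-project : ∀ {x y} (q : Walk Γ x y) → len (project q) ≤ len q
  len-project nil = z≤n
  len-project (cons e q) with adj-lex e
  ... | inj₁ _          = s≤s (len-project q)
  ... | inj₂ (fst≡ , _) =
    subst (_≤ suc (len q)) (sym (len-subst (sym fst≡) (project q))) (m≤n⇒m≤1+n (len-project q))

  liftTo : ∀ y {a} → Walk G a (fst y) → Walk Γ (combine a (snd y)) y
  liftTo y nil = ≡⇒walk (combine-fst-snd y)
  liftTo y (cons {w = w} e p) =
    cons (adj-across (subst₂ (Adj G) (sym (fst-combine _ (snd y))) (sym (fst-combine w (snd y))) e))
         (liftTo y p)

  len-liftTo : ∀ y {a} (p : Walk G a (fst y)) → len (liftTo y p) ≡ len p
  len-liftTo y nil        = len-≡⇒walk (combine-fst-snd y)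
  len-liftTo y (cons e p) = cong suc (len-liftTo y p)

  lift : ∀ {a b x y} (p : Walk G a b) → 1 ≤ len p → fst x ≡ a → fst y ≡ b → Walk Γ x y
  lift {y = y} (cons {w = w} e p) _ refl refl =
    cons (adj-across (subst (Adj G _) (sym (fst-combine w (snd y))) e)) (liftTo y p)

  len-lift : ∀ {a b x y} (p : Walk G a b) (p-nonempty : 1 ≤ len p)
    (fst-x : fst x ≡ a) (fst-y : fst y ≡ b) → len (lift p p-nonempty fst-x fst-y) ≡ len p
  len-lift {y = y} (cons e p) _ refl refl = cong suc (len-liftTo y p)

  distAtLeast-project : ∀ {x y k} → DistAtLeast G (fst x) (fst y) k → DistAtLeast Γ x y k
  distAtLeast-project dist q = ≤-trans (dist (project q)) (len-project q)

  distAtLeast-lift : ∀ {x y k} → fst x ≢ fst y → DistAtLeast Γ x y k → DistAtLeast G (fst x) (fst y) k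
  distAtLeast-lift fst≢ dist q =
    subst (_ ≤_) (len-lift q nonempty refl refl) (dist (lift q nonempty refl refl))
    where nonempty = walk-nonempty q fst≢

  detour : NoIsolated G → ∀ {x y} → fst x ≡ fst y → ∃[ q ] (len {Γ} {x} {y} q ≤ 2)
  detour noIsolated {x} {y} fst≡ with noIsolated (fst x)
  ... | g , e = q , ≤-reflexive (len-lift walkG (s≤s z≤n) refl refl)
    where
    walkG : Walk G (fst x) (fst y)
    walkG = cons e (cons (subst (Adj G g) fst≡ (Adj-sym G e)) nil)
    q = lift walkG (s≤s z≤n) refl refl

  ⊠-outerGP : NoIsolated G → ∀ P S → IsOuterGP G P → Independent G P → AdjacentTwins H S →
    IsOuterGP Γ (P ⊠ S)
  ⊠-outerGP noIsolated P S P-outerGP P-independent S-twins = noGeodesicThrough⇒outerGP (P ⊠ S) ngt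
    where
    members : ∀ {x} → x ∈ P ⊠ S → fst x ∈ P × snd x ∈ S
    members {x} x∈ = combine∈⊠ (subst (_∈ P ⊠ S) (sym (combine-fst-snd x)) x∈)

    across : ∀ {u z y} → fst u ∈ P → fst z ∈ P → fst u ≢ fst z → Adj Γ z y →
      (p : Walk Γ u z) → ¬ DistAtLeast Γ u y (suc (len p))
    across {u} {z} {y} u∈P z∈P fst≢ z~y p geodesic with adj-lex z~y
    ... | inj₂ (fst-zy , _) = ≤⇒≯ (subst (_ ≤_) (len-lift p̄ p̄-nonempty refl (sym fst-zy)) (geodesic q))
                                    (s≤s (len-project p))
      where
      p̄ = project p
      p̄-nonempty = walk-nonempty p̄ fst≢
      q = lift p̄ p̄-nonempty refl (sym fst-zy)
    ... | inj₁ e with fst y ≟ fst u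
    ...   | yes fst-yu = P-independent _ _ u∈P z∈P (Adj-sym G (subst (Adj G _) fst-yu e))
    ...   | no  fst-yu = outerGP⇒noGeodesicThrough P P-outerGP u∈P z∈P e (project p) (walk-nonempty _ fst≢)
                           (distAtLeast-lift (λ fst-uy → fst-yu (sym fst-uy))
                             (distAtLeast-weaken (s≤s (len-project p)) geodesic))

    within : ∀ {u z y} → snd u ∈ S → snd z ∈ S → fst u ≡ fst z → Adj Γ z y →
      (p : Walk Γ u z) → 1 ≤ len p → ¬ DistAtLeast Γ u y (suc (len p))
    within {u} {z} {y} u∈S z∈S fst-uz z~y p p-nonempty geodesic with adj-lex z~y
    ... | inj₁ e =
      adj⇒¬distAtLeast (adj-across (subst (λ g → Adj G g _) (sym fst-uz) e)) (s≤s p-nonempty) geodesic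
    ... | inj₂ (fst-zy , snd-zy)
      with adj-lex (short-geodesic⇒adj p p-nonempty geodesic (detour noIsolated (trans fst-uz fst-zy)))
    ...   | inj₁ e = Adj-irrefl G (subst (Adj G _) (sym fst-uz) e)
    ...   | inj₂ (_ , snd-uz) with snd y ≟ snd u
    ...     | yes snd-yu = ≡⇒¬distAtLeast (vertex-≡ (trans fst-uz fst-zy) (sym snd-yu)) (s≤s z≤n) geodesic
    ...     | no  snd-yu =
      adj⇒¬distAtLeast (adj-within (trans fst-uz fst-zy) (S-twins u∈S z∈S snd-uz snd-zy snd-yu))
                       (s≤s p-nonempty) geodesic

    ngt : NoGeodesicThrough Γ (P ⊠ S)
    ngt {u} {z} u∈ z∈ z~y p p-nonempty with fst u ≟ fst z
    ... | no  fst≢ = across (proj₁ (members u∈)) (proj₁ (members z∈)) fst≢ z~y p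
    ... | yes fst≡ = within (proj₂ (members u∈)) (proj₂ (members z∈)) fst≡ z~y p p-nonempty

  adj-layer : ∀ {g h h′} → Adj H h h′ → Adj Γ (combine g h) (combine g h′)
  adj-layer {g} {h} {h′} e =
    adj-within (trans (fst-combine g h) (sym (fst-combine g h′)))
               (subst₂ (Adj H) (sym (snd-combine g h)) (sym (snd-combine g h′)) e)

  adj-layer⁻ : ∀ {g h h′} → Adj Γ (combine g h) (combine g h′) → Adj H h h′
  adj-layer⁻ {g} {h} {h′} e with adj-lex e
  ... | inj₁ e′      = ⊥-elim (Adj-irrefl G (subst₂ (Adj G) (fst-combine g h) (fst-combine g h′) e′))
  ... | inj₂ (_ , e′) = subst₂ (Adj H) (snd-combine g h) (snd-combine g h′) e′

  row-adjacentTwins : ∀ (xss : Vec (Subset (n H)) (n G)) g →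
    IsOuterGP Γ (concat xss) → AdjacentTwins H (lookup xss g)
  row-adjacentTwins xss g X-outerGP {h} {h′} {w} h∈ h′∈ h~h′ h′~w w≢h =
    adj-layer⁻ (outerGP⇒adjacentTwins (concat xss) X-outerGP (combine∈concat⁺ xss h∈) (combine∈concat⁺ xss h′∈)
                  (adj-layer h~h′) (adj-layer h′~w) gw≢gh)
    where
    gw≢gh : combine g w ≢ combine g h
    gw≢gh eq = w≢h (trans (sym (snd-combine g w)) (trans (cong snd eq) (snd-combine g h)))

  occupied-outerGP : ∀ (xss : Vec (Subset (n H)) (n G)) →
    IsOuterGP Γ (concat xss) → IsOuterGP G (occupied xss)
  occupied-outerGP xss X-outerGP = noGeodesicThrough⇒outerGP (occupied xss) ngt
    where
    ngt : NoGeodesicThrough G (occupied xss)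
    ngt {g} {g′} {y} g∈ g′∈ e p p-nonempty geodesic with ∈-occupied xss g∈ | ∈-occupied xss g′∈
    ... | h , h∈ | h′ , h′∈ =
      outerGP⇒noGeodesicThrough (concat xss) X-outerGP (combine∈concat⁺ xss h∈) (combine∈concat⁺ xss h′∈)
        (adj-across (subst₂ (Adj G) (sym (fst-combine g′ h′)) (sym (fst-combine y h′)) e))
        q (subst (1 ≤_) (sym len-q) p-nonempty)
        (subst (λ k → DistAtLeast Γ _ _ (suc k)) (sym len-q) (distAtLeast-project geodesic′))
      where
      q = lift p p-nonempty (fst-combine g h) (fst-combine g′ h′)
      len-q = len-lift p p-nonempty (fst-combine g h) (fst-combine g′ h′)
      geodesic′ = subst₂ (λ a b → DistAtLeast G a b _) (sym (fst-combine g h)) (sym (fst-combine y h′)) geodesic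

  ∣outerGP∣≤ : ∀ X → IsOuterGP Γ X → ∀ {b c} → (∀ P → IsOuterGP G P → ∣ P ∣ ≤ b) →
    (∀ S → AdjacentTwins H S → ∣ S ∣ ≤ c) → ∣ X ∣ ≤ b * c
  ∣outerGP∣≤ X X-outerGP {b} {c} G-bound H-bound with group (n G) (n H) X
  ... | xss , refl = begin
    ∣ concat xss ∣       ≤⟨ ∣concat∣≤∣occupied∣* xss (λ g → H-bound _ (row-adjacentTwins xss g X-outerGP)) ⟩
    ∣ occupied xss ∣ * c ≤⟨ *-monoˡ-≤ c (G-bound _ (occupied-outerGP xss X-outerGP)) ⟩
    b * c                ∎
    where open ≤-Reasoning

  gpo-lex : NoIsolated G → NoTrueTwins G → ∀ {a b c} →
    IsGpo Γ a → IsGpo G b → Maximum (AdjacentTwins H) c → a ≡ b * c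
  gpo-lex noIsolated noTwins ((X , X-outerGP , refl) , Γ-bound) ((P , P-outerGP , refl) , G-bound)
          ((S , S-twins , refl) , H-bound) =
    ≤-antisym (∣outerGP∣≤ X X-outerGP G-bound H-bound)
              (subst (_≤ ∣ X ∣) (∣⊠∣ P S)
                     (Γ-bound (P ⊠ S) (⊠-outerGP noIsolated P S P-outerGP P-independent S-twins)))
    where
    P-independent : Independent G P
    P-independent = adjacentTwins⇒independent {G} noTwins P (outerGP⇒adjacentTwins P P-outerGP)

⁅⁆-independent : ∀ G (v : V G) → Independent G ⁅ v ⁆
⁅⁆-independent G v a b a∈ b∈ a~b =
  Adj-irrefl G (subst (Adj G a) (trans (x∈⁅y⁆⇒x≡y v b∈) (sym (x∈⁅y⁆⇒x≡y v a∈))) a~b)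

¬complete⇒vertex : ∀ G → ¬ Complete G → V G
¬complete⇒vertex G ¬complete = inhabitant (λ empty → ¬complete (λ u → ⊥-elim (empty u)))
  where
  inhabitant : ∀ {m} → ¬ ¬ Fin m → Fin m
  inhabitant {zero}  ¬¬fin = ⊥-elim (¬¬fin λ ())
  inhabitant {suc m} _     = fz

another-vertex : ∀ {m} → 2 ≤ m → (g : Fin m) → ∃[ g′ ] g′ ≢ g
another-vertex (s≤s (s≤s _)) g = punchIn g fz , punchInᵢ≢i g fz

connected⇒noIsolated : ∀ G → Connected G → 2 ≤ n G → NoIsolated G
connected⇒noIsolated G connected 2≤n g with another-vertex 2≤n g
... | g′ , g′≢g with connected g g′
...   | nil      = ⊥-elim (g′≢g refl)
...   | cons e _ = _ , e

module _ (H : Graph) where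

  join-diam≤2 : DiamAtMost (K₁+ H) 2
  join-diam≤2 fz     fz     = nil , z≤n
  join-diam≤2 fz     (fs v) = cons refl nil , s≤s z≤n
  join-diam≤2 (fs u) fz     = cons refl nil , s≤s z≤n
  join-diam≤2 (fs u) (fs v) = cons {w = fz} refl (cons refl nil) , s≤s (s≤s z≤n)

  adjacentTwins-join⁺ : ∀ {S} → AdjacentTwins H S → AdjacentTwins (K₁+ H) (false ∷ S)
  adjacentTwins-join⁺ twins {fz}                ()
  adjacentTwins-join⁺ twins {fs u} {fz}         _  ()
  adjacentTwins-join⁺ twins {fs u} {fs z} {fz}   _  _  _   _   _   = refl
  adjacentTwins-join⁺ twins {fs u} {fs z} {fs w} u∈ z∈ u~z z~w w≢u =
    twins (drop-there u∈) (drop-there z∈) u~z z~w (λ w≡u → w≢u (cong fs w≡u))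

  adjacentTwins-join⁻ : ∀ {b T} → AdjacentTwins (K₁+ H) (b ∷ T) → AdjacentTwins H T
  adjacentTwins-join⁻ twins u∈ z∈ u~z z~w w≢u =
    twins (thereᵛ u∈) (thereᵛ z∈) u~z z~w (λ w≡u → w≢u (suc-injective w≡u))

  apex-twin⇒universal : ∀ {T h} → AdjacentTwins (K₁+ H) (true ∷ T) → h ∈ T → Universal H h
  apex-twin⇒universal twins h∈ w w≢h =
    twins (thereᵛ h∈) hereᵛ refl refl (λ w≡h → w≢h (suc-injective w≡h))

  maximum-join : ¬ HasUniversal H → V H → ∀ {c} →
    Maximum (IsOuterGP (K₁+ H)) c → Maximum (AdjacentTwins H) c
  maximum-join noUniversal h₀ ((T′ , T′-outerGP , refl) , bound) = witness T′ T′-outerGP , bound′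
    where
    bound′ : ∀ S → AdjacentTwins H S → ∣ S ∣ ≤ ∣ T′ ∣
    bound′ S twins = bound (false ∷ S) (adjacentTwins⇒outerGP join-diam≤2 _ (adjacentTwins-join⁺ twins))

    witness : ∀ T′ → IsOuterGP (K₁+ H) T′ → ∃[ S ] (AdjacentTwins H S × ∣ S ∣ ≡ ∣ T′ ∣)
    witness (false ∷ T) outerGP = T , adjacentTwins-join⁻ (outerGP⇒adjacentTwins _ outerGP) , refl
    witness (true ∷ T)  outerGP =
      ⁅ h₀ ⁆ , independent⇒adjacentTwins {H} _ (⁅⁆-independent H h₀) , trans (∣⁅x⁆∣≡1 h₀) (cong suc (sym ∣T∣≡0))
      where
      ∣T∣≡0 : ∣ T ∣ ≡ 0
      ∣T∣≡0 = trans (cong ∣_∣ (Empty-unique λ (h , h∈) →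
                noUniversal (h , apex-twin⇒universal (outerGP⇒adjacentTwins _ outerGP) h∈))) (∣⊥∣≡0 (n H))

theorem5p5 : (G H : Graph) → Connected G → 2 ≤ n G → NoTrueTwins G →
    Connected H → ¬ Complete H →
    ((¬ HasUniversal H) →
      ∀ a b c → IsGpo (G ∘L H) a → IsGpo G b → IsGpo (K₁+ H) c → a ≡ b * c)
    ×
    (Diam H 2 →
      ∀ a b c → IsGpo (G ∘L H) a → IsGpo G b → IsGpo H c → a ≡ b * c)
    ×
    (NoTrueTwins H →
      ∀ a b c → IsGpo (G ∘L H) a → IsGpo G b → IsAlpha H c → a ≡ b * c)
theorem5p5 G H G-connected 2≤n G-noTwins _ H-incomplete =
  (λ H-noUniversal _ _ _ lex-gpo G-gpo join-gpo →
     gpo-G∘H lex-gpo G-gpo (maximum-join H H-noUniversal (¬complete⇒vertex H H-incomplete) join-gpo)) ,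
  (λ H-diam _ _ _ lex-gpo G-gpo H-gpo →
     gpo-G∘H lex-gpo G-gpo
       (maximum-resp-⇔ outerGP⇒adjacentTwins (adjacentTwins⇒outerGP (proj₁ H-diam)) H-gpo)) ,
  (λ H-noTwins _ _ _ lex-gpo G-gpo H-alpha →
     gpo-G∘H lex-gpo G-gpo
       (maximum-resp-⇔ (independent⇒adjacentTwins {H}) (adjacentTwins⇒independent {H} H-noTwins) H-alpha))
  where
  gpo-G∘H : ∀ {a b c} → IsGpo (G ∘L H) a → IsGpo G b → Maximum (AdjacentTwins H) c → a ≡ b * c
  gpo-G∘H = Lex.gpo-lex G H (connected⇒noIsolated G G-connected 2≤n) G-noTwins
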